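{- Fix an integer $k\geq 1$. Let $\mathbb{F}=\mathbb{C}(x_0,\ldots,x_{2k},a)$ and define $x_n\in\mathbb{F}$ ($n\in\mathbb{Z}$) by iterating $x_{n+2k+1}x_n=x_{n+2k}x_{n+1}+a(x_{n+k}+x_{n+k+1})$ forwards and backwards from $x_0,\ldots,x_{2k}$. Then $$\frac{x_{4k}-x_{ -2k}}{x_{2k}-x_0}=P^{(0)}+a\,P^{(1)}+a^2P^{(2)},$$ where $$P^{(0)}=1+\frac{x_0}{x_{2k}}+\frac{x_{2k}}{x_0},$$ $$P^{(1)}=\Big(1+\frac{x_{2k}}{x_0}\Big)\sum_{j=1}^k\frac{x_{j-1}+x_j}{x_{j+k-1}x_{j+k}}+\Big(1+\frac{x_0}{x_{2k}}\Big)\sum_{j=1}^k\frac{x_{j+k-1}+x_{j+k}}{x_{j-1}x_j},$$ $$P^{(2)}=\frac{1}{x_kx_{2k}}+\sum_{j=0}^{k-1}\frac{1}{x_j}\Big(\frac{1}{x_{j+k}}+\frac{1}{x_{j+k+1}}\Big)+\sum_{\ell=1}^{k-1}\sum_{m=1}^{\ell}\frac{(x_\ell+x_{\ell+1})(x_{k+m-1}+x_{k+m})}{x_{k+\ell}x_{k+\ell+1}x_{m-1}x_m}.$$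
   Context: All $x_n$ produced by the recurrence are nonzero elements of $\mathbb{F}$, so the iteration is well defined. -}

module Defs where

open import Level using (Level; suc; _⊔_)
open import Data.Nat as ℕ using (ℕ; zero) renaming (suc to sucℕ)
open import Data.Integer as ℤ using (ℤ; +_)
open import Relation.Nullary using (¬_)
open import Algebra.Bundles using (CommutativeRing)

-- The inverse is a total function; its value at 0 is irrelevant.
record Field (c ℓ : Level) : Set (suc (c ⊔ ℓ)) where
  field
    commutativeRing : CommutativeRing c ℓ
  open CommutativeRing commutativeRing public
  field
    _⁻¹     : Carrier → Carrier
    0≉1     : ¬ (0# ≈ 1#)
    inverse : ∀ y → ¬ (y ≈ 0#) → (y * (y ⁻¹)) ≈ 1#

  infixl 7 _/_
  _/_ : Carrier → Carrier → Carrier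
  u / v = u * (v ⁻¹)

  fromℕ : ℕ → Carrier
  fromℕ zero     = 0#
  fromℕ (sucℕ n) = 1# + fromℕ n

  sumBelow : ℕ → (ℕ → Carrier) → Carrier
  sumBelow zero     f = 0#
  sumBelow (sucℕ n) f = sumBelow n f + f n

  sum1to : ℕ → (ℕ → Carrier) → Carrier
  sum1to n f = sumBelow n (λ i → f (sucℕ i))

CharZero : ∀ {c ℓ} → Field c ℓ → Set ℓ
CharZero F = ∀ n → ¬ (fromℕ (sucℕ n) ≈ 0#)
  where open Field F

module Somos {c ℓ} (F : Field c ℓ) (k : ℕ) (a : Field.Carrier F)
             (x : ℤ → Field.Carrier F) where
  open Field F

  X : ℕ → Carrier
  X n = x (+ n)

  Recurrence : Set ℓ
  Recurrence = ∀ (n : ℤ) →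
    (x (n ℤ.+ + (2 ℕ.* k ℕ.+ 1)) * x n)
      ≈ ((x (n ℤ.+ + (2 ℕ.* k)) * x (n ℤ.+ + 1))
         + (a * (x (n ℤ.+ + k) + x (n ℤ.+ + (k ℕ.+ 1)))))

  P0 : Carrier
  P0 = 1# + (X 0 / X (2 ℕ.* k)) + (X (2 ℕ.* k) / X 0)

  P1 : Carrier
  P1 = ((1# + (X (2 ℕ.* k) / X 0))
          * sum1to k (λ j → (X (j ℕ.∸ 1) + X j) / (X (j ℕ.+ k ℕ.∸ 1) * X (j ℕ.+ k))))
     + ((1# + (X 0 / X (2 ℕ.* k)))
          * sum1to k (λ j → (X (j ℕ.+ k ℕ.∸ 1) + X (j ℕ.+ k)) / (X (j ℕ.∸ 1) * X j)))

  P2 : Carrier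
  P2 = (1# / (X k * X (2 ℕ.* k)))
     + sumBelow k (λ j → (1# / X j) * ((1# / X (j ℕ.+ k)) + (1# / X (j ℕ.+ k ℕ.+ 1))))
     + sum1to (k ℕ.∸ 1) (λ l → sum1to l (λ m →
         ((X l + X (l ℕ.+ 1)) * (X (k ℕ.+ m ℕ.∸ 1) + X (k ℕ.+ m)))
           / (X (k ℕ.+ l) * X (k ℕ.+ l ℕ.+ 1) * X (m ℕ.∸ 1) * X m)))

-- With y = 1/x, the recurrence says that the ratio x_{n+2k}/x_n grows by
-- a (x_{n+k} + x_{n+k+1}) y_n y_{n+1} from n to n+1.  Telescoping this once for
-- n < 2k, and a second time inside the increments for n ≥ k, expresses x_{4k}
-- through x_0, ..., x_{2k}.  The recurrence is invariant under n ↦ 2k - n, which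
-- exchanges x_{4k} with x_{-2k} and the two sums of P1 and fixes the double sum of
-- P2, so x_{-2k} is given by the same formula for the reflected sequence.  The
-- difference of the two formulas is (x_{2k} - x_0) times P0 + a P1 + a² P2 once the
-- telescoping identity
--   Σ_j (y_j + y_{j+1}) y_{j+k+1} + y_0 y_k = Σ_j y_j (y_{j+k} + y_{j+k+1}) + y_k y_{2k}
-- is used.

module Submission where

open import Defs
open import Data.List.Base using ([]; _∷_)
open import Data.Nat.Base as ℕ using (ℕ; zero; suc; _≥_)
import Data.Nat.Properties as ℕ
import Data.Nat.Tactic.RingSolver as ℕ-Solver
open import Data.Integer.Base as ℤ using (ℤ; +_)
import Data.Integer.Properties as ℤ
import Data.Integer.Tactic.RingSolver as ℤ-Solver
open import Data.Product.Base using (_×_; _,_)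
open import Function.Base using (_∘_)
open import Relation.Binary.PropositionalEquality as ≡ using (_≡_)
open import Relation.Nullary using (¬_)

module FieldProperties {c ℓ} (F : Field c ℓ) where
  open Field F
  open import Algebra.Solver.Ring.NaturalCoefficients.Default commutativeSemiring
  open import Relation.Binary.Reasoning.Setoid setoid

  *-nonzero : ∀ {u v} → ¬ u ≈ 0# → ¬ v ≈ 0# → ¬ u * v ≈ 0#
  *-nonzero {u} {v} u≉0 v≉0 uv≈0 = v≉0 (begin
    v                ≈⟨ *-identityˡ v ⟨
    1# * v           ≈⟨ *-congʳ (inverse u u≉0) ⟨
    (u * u ⁻¹) * v   ≈⟨ solve 3 (λ U I V → (U :* I) :* V := I :* (U :* V)) refl u (u ⁻¹) v ⟩
    u ⁻¹ * (u * v)   ≈⟨ *-congˡ uv≈0 ⟩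
    u ⁻¹ * 0#        ≈⟨ zeroʳ (u ⁻¹) ⟩
    0#               ∎)

  ⁻¹-unique : ∀ {u w} → ¬ u ≈ 0# → u * w ≈ 1# → w ≈ u ⁻¹
  ⁻¹-unique {u} {w} u≉0 uw≈1 = begin
    w                ≈⟨ *-identityʳ w ⟨
    w * 1#           ≈⟨ *-congˡ (inverse u u≉0) ⟨
    w * (u * u ⁻¹)   ≈⟨ solve 3 (λ W U I → W :* (U :* I) := (U :* W) :* I) refl w u (u ⁻¹) ⟩
    (u * w) * u ⁻¹   ≈⟨ *-congʳ uw≈1 ⟩
    1# * u ⁻¹        ≈⟨ *-identityˡ (u ⁻¹) ⟩
    u ⁻¹             ∎

  ⁻¹-distrib-* : ∀ {u v} → ¬ u ≈ 0# → ¬ v ≈ 0# → (u * v) ⁻¹ ≈ u ⁻¹ * v ⁻¹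
  ⁻¹-distrib-* {u} {v} u≉0 v≉0 = sym (⁻¹-unique (*-nonzero u≉0 v≉0) (begin
    (u * v) * (u ⁻¹ * v ⁻¹)
      ≈⟨ solve 4 (λ U V I J → (U :* V) :* (I :* J) := (U :* I) :* (V :* J)) refl u v (u ⁻¹) (v ⁻¹) ⟩
    (u * u ⁻¹) * (v * v ⁻¹)   ≈⟨ *-cong (inverse u u≉0) (inverse v v≉0) ⟩
    1# * 1#                   ≈⟨ *-identityˡ 1# ⟩
    1#                        ∎))

  *-cancel-/ : ∀ {d} u → ¬ d ≈ 0# → d * (u / d) ≈ u
  *-cancel-/ {d} u d≉0 = begin
    d * (u * d ⁻¹)   ≈⟨ solve 3 (λ D U I → D :* (U :* I) := U :* (D :* I)) refl d u (d ⁻¹) ⟩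
    u * (d * d ⁻¹)   ≈⟨ *-congˡ (inverse d d≉0) ⟩
    u * 1#           ≈⟨ *-identityʳ u ⟩
    u                ∎

  divide-by-product : ∀ {p q u v w} → ¬ u ≈ 0# → ¬ v ≈ 0# →
    p * u ≈ q * v + w → p * v ⁻¹ ≈ q * u ⁻¹ + w * (u ⁻¹ * v ⁻¹)
  divide-by-product {p} {q} {u} {v} {w} u≉0 v≉0 eq = begin
    p * v ⁻¹                              ≈⟨ *-identityʳ _ ⟨
    p * v ⁻¹ * 1#                         ≈⟨ *-congˡ (inverse u u≉0) ⟨
    p * v ⁻¹ * (u * u ⁻¹)
      ≈⟨ solve 4 (λ P J U I → P :* J :* (U :* I) := (P :* U) :* (I :* J)) refl p (v ⁻¹) u (u ⁻¹) ⟩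
    (p * u) * (u ⁻¹ * v ⁻¹)               ≈⟨ *-congʳ eq ⟩
    (q * v + w) * (u ⁻¹ * v ⁻¹)
      ≈⟨ solve 5 (λ P V W I J → (P :* V :+ W) :* (I :* J) := P :* I :* (V :* J) :+ W :* (I :* J))
           refl q v w (u ⁻¹) (v ⁻¹) ⟩
    q * u ⁻¹ * (v * v ⁻¹) + w * (u ⁻¹ * v ⁻¹)   ≈⟨ +-congʳ (*-congˡ (inverse v v≉0)) ⟩
    q * u ⁻¹ * 1# + w * (u ⁻¹ * v ⁻¹)           ≈⟨ +-congʳ (*-identityʳ _) ⟩
    q * u ⁻¹ + w * (u ⁻¹ * v ⁻¹)                ∎

  x+y≈z+w⇒x-z≈w-y : ∀ {x y z w} → x + y ≈ z + w → x - z ≈ w - y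
  x+y≈z+w⇒x-z≈w-y {x} {y} {z} {w} eq = begin
    x - z                     ≈⟨ +-identityʳ _ ⟨
    x - z + 0#                ≈⟨ +-congˡ (-‿inverseʳ y) ⟨
    (x + - z) + (y + - y)
      ≈⟨ solve 4 (λ X Z Y N → (X :+ Z) :+ (Y :+ N) := (X :+ Y) :+ (Z :+ N)) refl x (- z) y (- y) ⟩
    (x + y) + (- z + - y)     ≈⟨ +-congʳ eq ⟩
    (z + w) + (- z + - y)
      ≈⟨ solve 4 (λ Z W M N → (Z :+ W) :+ (M :+ N) := (W :+ N) :+ (Z :+ M)) refl z w (- z) (- y) ⟩
    (w + - y) + (z + - z)     ≈⟨ +-congˡ (-‿inverseʳ z) ⟩
    w - y + 0#                ≈⟨ +-identityʳ _ ⟩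
    w - y                     ∎

  sumBelow-cong : ∀ n {f g : ℕ → Carrier} → (∀ i → f i ≈ g i) → sumBelow n f ≈ sumBelow n g
  sumBelow-cong zero    f≈g = refl
  sumBelow-cong (suc n) f≈g = +-cong (sumBelow-cong n f≈g) (f≈g n)

  sumBelow-distrib-+ : ∀ n (f g : ℕ → Carrier) →
    sumBelow n (λ i → f i + g i) ≈ sumBelow n f + sumBelow n g
  sumBelow-distrib-+ zero    f g = sym (+-identityʳ 0#)
  sumBelow-distrib-+ (suc n) f g = begin
    sumBelow n (λ i → f i + g i) + (f n + g n)      ≈⟨ +-congʳ (sumBelow-distrib-+ n f g) ⟩
    (sumBelow n f + sumBelow n g) + (f n + g n)
      ≈⟨ solve 4 (λ A B C D → (A :+ B) :+ (C :+ D) := (A :+ C) :+ (B :+ D)) refl _ _ (f n) (g n) ⟩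
    (sumBelow n f + f n) + (sumBelow n g + g n)     ∎

  sumBelow-*ˡ : ∀ n u (f : ℕ → Carrier) → sumBelow n (λ i → u * f i) ≈ u * sumBelow n f
  sumBelow-*ˡ zero    u f = sym (zeroʳ u)
  sumBelow-*ˡ (suc n) u f = trans (+-congʳ (sumBelow-*ˡ n u f)) (sym (distribˡ u _ _))

  sumBelow-linear : ∀ n u v (f g : ℕ → Carrier) →
    sumBelow n (λ i → u * f i + v * g i) ≈ u * sumBelow n f + v * sumBelow n g
  sumBelow-linear n u v f g =
    trans (sumBelow-distrib-+ n _ _) (+-cong (sumBelow-*ˡ n u f) (sumBelow-*ˡ n v g))

  sumBelow-suc : ∀ n (f : ℕ → Carrier) → sumBelow (suc n) f ≈ f 0 + sumBelow n (f ∘ suc)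
  sumBelow-suc zero    f = trans (+-identityˡ (f 0)) (sym (+-identityʳ (f 0)))
  sumBelow-suc (suc n) f = trans (+-congʳ (sumBelow-suc n f)) (+-assoc _ _ _)

  sumBelow-+ℕ : ∀ m n (f : ℕ → Carrier) →
    sumBelow (n ℕ.+ m) f ≈ sumBelow m f + sumBelow n (λ i → f (i ℕ.+ m))
  sumBelow-+ℕ m zero    f = sym (+-identityʳ _)
  sumBelow-+ℕ m (suc n) f = trans (+-congʳ (sumBelow-+ℕ m n f)) (+-assoc _ _ _)

  telescope : ∀ {g h : ℕ → Carrier} → (∀ n → g (suc n) ≈ g n + h n) →
    ∀ m → g m ≈ g 0 + sumBelow m h
  telescope step zero    = sym (+-identityʳ _)
  telescope step (suc m) = trans (step m) (trans (+-congʳ (telescope step m)) (+-assoc _ _ _))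

  Mirrored : ℕ → (ℕ → Carrier) → (ℕ → Carrier) → Set ℓ
  Mirrored n f g = ∀ i j → suc (i ℕ.+ j) ≡ n → f i ≈ g j

  Mirrored-last : ∀ {n f g} → Mirrored (suc n) f g → f n ≈ g 0
  Mirrored-last {n} f≈g = f≈g n 0 (≡.cong suc (ℕ.+-identityʳ n))

  Mirrored-init : ∀ {n f g} → Mirrored (suc n) f g → Mirrored n f (g ∘ suc)
  Mirrored-init f≈g i j eq = f≈g i (suc j) (≡.cong suc (≡.trans (ℕ.+-suc i j) eq))

  sumBelow-reverse : ∀ n {f g} → Mirrored n f g → sumBelow n f ≈ sumBelow n g
  sumBelow-reverse zero    f≈g = refl
  sumBelow-reverse (suc n) {f} {g} f≈g = begin
    sumBelow n f + f n            ≈⟨ +-cong (sumBelow-reverse n (Mirrored-init f≈g)) (Mirrored-last f≈g) ⟩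
    sumBelow n (g ∘ suc) + g 0    ≈⟨ +-comm _ _ ⟩
    g 0 + sumBelow n (g ∘ suc)    ≈⟨ sumBelow-suc n g ⟨
    sumBelow (suc n) g            ∎

  doubleSum : ℕ → (ℕ → Carrier) → (ℕ → Carrier) → Carrier
  doubleSum n f g = sumBelow n (λ q → f q * sumBelow q g)

  doubleSum-suc : ∀ n (f g : ℕ → Carrier) →
    doubleSum (suc n) f g ≈ sumBelow n (λ q → f (suc q) * sumBelow (suc q) g)
  doubleSum-suc n f g =
    trans (sumBelow-suc n _) (trans (+-congʳ (zeroʳ (f 0))) (+-identityˡ _))

  doubleSum-peel : ∀ n (f g : ℕ → Carrier) →
    doubleSum (suc n) f g ≈ g 0 * sumBelow n (f ∘ suc) + doubleSum n (f ∘ suc) (g ∘ suc)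
  doubleSum-peel n f g = begin
    doubleSum (suc n) f g
      ≈⟨ doubleSum-suc n f g ⟩
    sumBelow n (λ q → f (suc q) * sumBelow (suc q) g)
      ≈⟨ sumBelow-cong n (λ q → *-congˡ (sumBelow-suc q g)) ⟩
    sumBelow n (λ q → f (suc q) * (g 0 + sumBelow q (g ∘ suc)))
      ≈⟨ sumBelow-cong n (λ q → trans (distribˡ _ _ _) (+-congʳ (*-comm _ _))) ⟩
    sumBelow n (λ q → g 0 * f (suc q) + f (suc q) * sumBelow q (g ∘ suc))
      ≈⟨ sumBelow-distrib-+ n _ _ ⟩
    sumBelow n (λ q → g 0 * f (suc q)) + doubleSum n (f ∘ suc) (g ∘ suc)
      ≈⟨ +-congʳ (sumBelow-*ˡ n (g 0) (f ∘ suc)) ⟩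
    g 0 * sumBelow n (f ∘ suc) + doubleSum n (f ∘ suc) (g ∘ suc)
      ∎

  doubleSum-reverse : ∀ n {f g f′ g′} → Mirrored n f f′ → Mirrored n g g′ →
    doubleSum n f g ≈ doubleSum n g′ f′
  doubleSum-reverse zero    f≈f′ g≈g′ = refl
  doubleSum-reverse (suc n) {f} {g} {f′} {g′} f≈f′ g≈g′ = begin
    doubleSum n f g + f n * sumBelow n g
      ≈⟨ +-cong (doubleSum-reverse n (Mirrored-init f≈f′) (Mirrored-init g≈g′))
                (*-cong (Mirrored-last f≈f′) (sumBelow-reverse n (Mirrored-init g≈g′))) ⟩
    doubleSum n (g′ ∘ suc) (f′ ∘ suc) + f′ 0 * sumBelow n (g′ ∘ suc)
      ≈⟨ +-comm _ _ ⟩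
    f′ 0 * sumBelow n (g′ ∘ suc) + doubleSum n (g′ ∘ suc) (f′ ∘ suc)
      ≈⟨ doubleSum-peel n g′ f′ ⟨
    doubleSum (suc n) g′ f′
      ∎

private
  k+k≡2k : ∀ k → k ℕ.+ k ≡ 2 ℕ.* k
  k+k≡2k = ℕ-Solver.solve-∀

  2k+2k≡4k : ∀ k → 2 ℕ.* k ℕ.+ 2 ℕ.* k ≡ 4 ℕ.* k
  2k+2k≡4k = ℕ-Solver.solve-∀

  [k+1]+k≡2k+1 : ∀ k → k ℕ.+ 1 ℕ.+ k ≡ 2 ℕ.* k ℕ.+ 1
  [k+1]+k≡2k+1 = ℕ-Solver.solve-∀

  k+[k+1]≡2k+1 : ∀ k → k ℕ.+ (k ℕ.+ 1) ≡ 2 ℕ.* k ℕ.+ 1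
  k+[k+1]≡2k+1 = ℕ-Solver.solve-∀

  n+[k+1]≡1+[n+k] : ∀ n k → n ℕ.+ (k ℕ.+ 1) ≡ suc (n ℕ.+ k)
  n+[k+1]≡1+[n+k] = ℕ-Solver.solve-∀

  n+k+k≡n+2k : ∀ n k → n ℕ.+ k ℕ.+ k ≡ n ℕ.+ 2 ℕ.* k
  n+k+k≡n+2k = ℕ-Solver.solve-∀

mirror-sums : ∀ {i j k} → suc (i ℕ.+ j) ≡ k →
  (i ℕ.+ k ℕ.+ suc j ≡ 2 ℕ.* k) × (suc (i ℕ.+ k) ℕ.+ j ≡ 2 ℕ.* k) ×
  (i ℕ.+ suc (j ℕ.+ k) ≡ 2 ℕ.* k) × (suc i ℕ.+ (j ℕ.+ k) ≡ 2 ℕ.* k)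
mirror-sums {i} {j} ≡.refl =
  ℕ-Solver.solve (i ∷ j ∷ []) , ℕ-Solver.solve (i ∷ j ∷ []) ,
  ℕ-Solver.solve (i ∷ j ∷ []) , ℕ-Solver.solve (i ∷ j ∷ [])

module SomosProperties {c ℓ} (F : Field c ℓ) (k : ℕ) (a : Field.Carrier F) where
  open Field F
  open FieldProperties F
  open import Algebra.Solver.Ring.NaturalCoefficients.Default commutativeSemiring
  open import Relation.Binary.Reasoning.Setoid setoid

  private
    shift-index : ∀ C n p q → C ℤ.- (n ℤ.+ p) ≡ C ℤ.- (n ℤ.+ (p ℤ.+ q)) ℤ.+ q
    shift-index = ℤ-Solver.solve-∀

  Recurrence-reflect : ∀ x C → Somos.Recurrence F k a x → Somos.Recurrence F k a (λ n → x (C ℤ.- n))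
  Recurrence-reflect x C rec n = begin
    x m * x (C ℤ.- n)
      ≈⟨ *-comm _ _ ⟩
    x (C ℤ.- n) * x m
      ≈⟨ *-congʳ (trans (reflexive (≡.cong (λ z → x (C ℤ.- z)) (≡.sym (ℤ.+-identityʳ n)))) (mirror ≡.refl)) ⟩
    x (m ℤ.+ + (2 ℕ.* k ℕ.+ 1)) * x m
      ≈⟨ rec m ⟩
    x (m ℤ.+ + (2 ℕ.* k)) * x (m ℤ.+ + 1) + a * (x (m ℤ.+ + k) + x (m ℤ.+ + (k ℕ.+ 1)))
      ≈⟨ +-cong (*-cong (sym (mirror (ℕ.+-comm 1 (2 ℕ.* k)))) (sym (mirror ≡.refl)))
                (*-congˡ (+-cong (sym (mirror ([k+1]+k≡2k+1 k)))
                                  (sym (mirror (k+[k+1]≡2k+1 k))))) ⟩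
    x (C ℤ.- (n ℤ.+ + 1)) * x (C ℤ.- (n ℤ.+ + (2 ℕ.* k)))
      + a * (x (C ℤ.- (n ℤ.+ + (k ℕ.+ 1))) + x (C ℤ.- (n ℤ.+ + k)))
      ≈⟨ +-cong (*-comm _ _) (*-congˡ (+-comm _ _)) ⟩
    x (C ℤ.- (n ℤ.+ + (2 ℕ.* k))) * x (C ℤ.- (n ℤ.+ + 1))
      + a * (x (C ℤ.- (n ℤ.+ + k)) + x (C ℤ.- (n ℤ.+ + (k ℕ.+ 1))))
      ∎
    where
    m : ℤ
    m = C ℤ.- (n ℤ.+ + (2 ℕ.* k ℕ.+ 1))
    mirror : ∀ {p q} → p ℕ.+ q ≡ 2 ℕ.* k ℕ.+ 1 → x (C ℤ.- (n ℤ.+ + p)) ≈ x (m ℤ.+ + q)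
    mirror {p} {q} p+q≡ = reflexive (≡.cong x (≡.trans (shift-index C n (+ p) (+ q))
                                                 (≡.cong (λ r → C ℤ.- (n ℤ.+ + r) ℤ.+ + q) p+q≡)))

  module Orbit (x : ℤ → Carrier) where
    open Somos F k a x using (X)

    X-cong : ∀ {m n} → m ≡ n → X m ≈ X n
    X-cong eq = reflexive (≡.cong X eq)

    y : ℕ → Carrier
    y n = X n ⁻¹

    ratio : ℕ → Carrier
    ratio n = X (n ℕ.+ 2 ℕ.* k) / X n

    e f t t̃ : ℕ → Carrier
    e n = (X (n ℕ.+ k) + X (suc (n ℕ.+ k))) * (y n * y (suc n))
    f n = (X n + X (suc n)) * (y (n ℕ.+ k) * y (suc (n ℕ.+ k)))
    t n = y n * (y (n ℕ.+ k) + y (suc (n ℕ.+ k)))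
    t̃ n = (y n + y (suc n)) * y (suc (n ℕ.+ k))

    -- S and E are the two sums of P1, D is the double sum and T the middle sum of P2.
    E S D T T̃ : Carrier
    E = sumBelow k e
    S = sumBelow k f
    D = doubleSum k f e
    T = sumBelow k t
    T̃ = sumBelow k t̃

    T̃+y₀yₖ≈T+yₖy₂ₖ : T̃ + y 0 * y k ≈ T + y k * y (2 ℕ.* k)
    T̃+y₀yₖ≈T+yₖy₂ₖ = begin
      T̃ + h 0
        ≈⟨ +-congʳ (trans (sumBelow-cong k (λ _ → distribʳ _ _ _)) (sumBelow-distrib-+ k g (h ∘ suc))) ⟩
      (sumBelow k g + sumBelow k (h ∘ suc)) + h 0
        ≈⟨ solve 3 (λ G H L → (G :+ H) :+ L := G :+ (L :+ H)) refl _ _ _ ⟩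
      sumBelow k g + (h 0 + sumBelow k (h ∘ suc))
        ≈⟨ +-congˡ (sumBelow-suc k h) ⟨
      sumBelow k g + (sumBelow k h + h k)
        ≈⟨ solve 3 (λ G H L → G :+ (H :+ L) := (H :+ G) :+ L) refl _ _ _ ⟩
      (sumBelow k h + sumBelow k g) + h k
        ≈⟨ +-cong (trans (sym (sumBelow-distrib-+ k h g)) (sumBelow-cong k (λ _ → sym (distribˡ _ _ _))))
                  (*-congˡ (reflexive (≡.cong y (k+k≡2k k)))) ⟩
      T + y k * y (2 ℕ.* k)
        ∎
      where
      h g : ℕ → Carrier
      h n = y n * y (n ℕ.+ k)
      g n = y n * y (suc (n ℕ.+ k))

    module Forward (rec : Somos.Recurrence F k a x) (x≉0 : ∀ n → ¬ x n ≈ 0#) where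
      X≉0 : ∀ n → ¬ X n ≈ 0#
      X≉0 n = x≉0 (+ n)

      X*y≈1 : ∀ n → X n * y n ≈ 1#
      X*y≈1 n = inverse (X n) (X≉0 n)

      recurrenceℕ : ∀ n → X (suc (n ℕ.+ 2 ℕ.* k)) * X n
                          ≈ X (n ℕ.+ 2 ℕ.* k) * X (suc n) + a * (X (n ℕ.+ k) + X (suc (n ℕ.+ k)))
      recurrenceℕ n = begin
        X (suc (n ℕ.+ 2 ℕ.* k)) * X n
          ≈⟨ *-congʳ (X-cong (≡.sym (n+[k+1]≡1+[n+k] n (2 ℕ.* k)))) ⟩
        X (n ℕ.+ (2 ℕ.* k ℕ.+ 1)) * X n
          ≈⟨ rec (+ n) ⟩
        X (n ℕ.+ 2 ℕ.* k) * X (n ℕ.+ 1) + a * (X (n ℕ.+ k) + X (n ℕ.+ (k ℕ.+ 1)))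
          ≈⟨ +-cong (*-congˡ (X-cong (ℕ.+-comm n 1)))
                    (*-congˡ (+-congˡ (X-cong (n+[k+1]≡1+[n+k] n k)))) ⟩
        X (n ℕ.+ 2 ℕ.* k) * X (suc n) + a * (X (n ℕ.+ k) + X (suc (n ℕ.+ k)))
          ∎

      ratio-suc : ∀ n → ratio (suc n) ≈ ratio n + a * e n
      ratio-suc n = trans (divide-by-product (X≉0 n) (X≉0 (suc n)) (recurrenceℕ n)) (+-congˡ (*-assoc _ _ _))

      X-shift : ∀ m → X (m ℕ.+ 2 ℕ.* k) ≈ X m * (ratio 0 + a * sumBelow m e)
      X-shift m = begin
        X (m ℕ.+ 2 ℕ.* k)                               ≈⟨ *-cancel-/ _ (X≉0 m) ⟨
        X m * ratio m                                   ≈⟨ *-congˡ (telescope {ratio} {λ i → a * e i} ratio-suc m) ⟩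
        X m * (ratio 0 + sumBelow m (λ i → a * e i))    ≈⟨ *-congˡ (+-congˡ (sumBelow-*ˡ m a e)) ⟩
        X m * (ratio 0 + a * sumBelow m e)              ∎

      e-cross : ∀ q → X (suc q) * (y (q ℕ.+ k) * y (suc (q ℕ.+ k))) * e q ≈ t q
      e-cross q = begin
        B * (Y₁ * Y₂) * ((A₁ + A₂) * (y q * y (suc q)))
          ≈⟨ solve 7 (λ B Y₁ Y₂ A₁ A₂ U V →
                      B :* (Y₁ :* Y₂) :* ((A₁ :+ A₂) :* (U :* V)) := U :* ((B :* V) :* ((A₁ :* Y₁) :* Y₂ :+ (A₂ :* Y₂) :* Y₁)))
               refl B Y₁ Y₂ A₁ A₂ (y q) (y (suc q)) ⟩
        y q * ((B * y (suc q)) * ((A₁ * Y₁) * Y₂ + (A₂ * Y₂) * Y₁))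
          ≈⟨ *-congˡ (*-cong (X*y≈1 (suc q)) (+-cong (*-congʳ (X*y≈1 (q ℕ.+ k))) (*-congʳ (X*y≈1 (suc (q ℕ.+ k)))))) ⟩
        y q * (1# * (1# * Y₂ + 1# * Y₁))
          ≈⟨ solve 3 (λ U Y₁ Y₂ → U :* (con 1 :* (con 1 :* Y₂ :+ con 1 :* Y₁)) := U :* (Y₁ :+ Y₂)) refl (y q) Y₁ Y₂ ⟩
        y q * (Y₁ + Y₂)
          ∎
        where
        B A₁ A₂ Y₁ Y₂ : Carrier
        B = X (suc q)
        A₁ = X (q ℕ.+ k)
        A₂ = X (suc (q ℕ.+ k))
        Y₁ = y (q ℕ.+ k)
        Y₂ = y (suc (q ℕ.+ k))

      e-shift : ∀ q → e (q ℕ.+ k) ≈ ratio 0 * f q + a * (f q * sumBelow q e + t q)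
      e-shift q = begin
        e (q ℕ.+ k)
          ≈⟨ *-congʳ (+-cong (trans (X-cong (n+k+k≡n+2k q k)) (X-shift q))
                             (trans (X-cong (≡.cong suc (n+k+k≡n+2k q k))) (X-shift (suc q)))) ⟩
        (X q * (r + a * ρ) + X (suc q) * (r + a * (ρ + e q))) * Y
          ≈⟨ solve 7 (λ A B r a ρ ε Y → (A :* (r :+ a :* ρ) :+ B :* (r :+ a :* (ρ :+ ε))) :* Y
                                      := r :* ((A :+ B) :* Y) :+ a :* ((A :+ B) :* Y :* ρ :+ B :* Y :* ε))
               refl (X q) (X (suc q)) r a ρ (e q) Y ⟩
        r * f q + a * (f q * ρ + X (suc q) * Y * e q)
          ≈⟨ +-congˡ (*-congˡ (+-congˡ (e-cross q))) ⟩
        r * f q + a * (f q * ρ + t q)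
          ∎
        where
        r ρ Y : Carrier
        r = ratio 0
        ρ = sumBelow q e
        Y = y (q ℕ.+ k) * y (suc (q ℕ.+ k))

      X-4k : X (4 ℕ.* k) ≈ X (2 ℕ.* k) * (ratio 0 + a * (E + (ratio 0 * S + a * (D + T))))
      X-4k = begin
        X (4 ℕ.* k)                                        ≈⟨ X-cong (≡.sym (2k+2k≡4k k)) ⟩
        X (2 ℕ.* k ℕ.+ 2 ℕ.* k)                            ≈⟨ X-shift (2 ℕ.* k) ⟩
        X (2 ℕ.* k) * (ratio 0 + a * sumBelow (2 ℕ.* k) e) ≈⟨ *-congˡ (+-congˡ (*-congˡ sum-e)) ⟩
        X (2 ℕ.* k) * (ratio 0 + a * (E + (ratio 0 * S + a * (D + T)))) ∎
        where
        sum-e : sumBelow (2 ℕ.* k) e ≈ E + (ratio 0 * S + a * (D + T))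
        sum-e = begin
          sumBelow (2 ℕ.* k) e
            ≡⟨ ≡.cong (λ n → sumBelow n e) (≡.sym (k+k≡2k k)) ⟩
          sumBelow (k ℕ.+ k) e
            ≈⟨ sumBelow-+ℕ k k e ⟩
          E + sumBelow k (λ q → e (q ℕ.+ k))
            ≈⟨ +-congˡ (sumBelow-cong k e-shift) ⟩
          E + sumBelow k (λ q → ratio 0 * f q + a * (f q * sumBelow q e + t q))
            ≈⟨ +-congˡ (sumBelow-linear k _ a f _) ⟩
          E + (ratio 0 * S + a * sumBelow k (λ q → f q * sumBelow q e + t q))
            ≈⟨ +-congˡ (+-congˡ (*-congˡ (sumBelow-distrib-+ k _ t))) ⟩
          E + (ratio 0 * S + a * (D + T))
            ∎

  module Mirror (x : ℤ → Carrier) (rec : Somos.Recurrence F k a x) (x≉0 : ∀ n → ¬ x n ≈ 0#) where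
    open Somos F k a x using (X)
    open Orbit x

    x̄ : ℤ → Carrier
    x̄ n = x (+ (2 ℕ.* k) ℤ.- n)

    module M = Orbit x̄

    private
      [p+q]-p≡q : ∀ p q → p ℤ.+ q ℤ.- p ≡ q
      [p+q]-p≡q = ℤ-Solver.solve-∀

      K-[K+K]≡-K : ∀ K → K ℤ.- (K ℤ.+ K) ≡ ℤ.- K
      K-[K+K]≡-K = ℤ-Solver.solve-∀

    x̄≡X : ∀ {i j} → i ℕ.+ j ≡ 2 ℕ.* k → x̄ (+ i) ≡ X j
    x̄≡X {i} {j} i+j≡2k =
      ≡.cong x (≡.trans (≡.cong (λ n → + n ℤ.- + i) (≡.sym i+j≡2k)) ([p+q]-p≡q (+ i) (+ j)))

    ē≈f : Mirrored k M.e f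
    ē≈f i j 1+i+j≡k = let (s₁ , s₂ , s₃ , s₄) = mirror-sums {i} {j} 1+i+j≡k in begin
      M.e i
        ≡⟨ ≡.cong₂ _*_ (≡.cong₂ _+_ (x̄≡X s₁) (x̄≡X s₂)) (≡.cong₂ _*_ (≡.cong _⁻¹ (x̄≡X s₃)) (≡.cong _⁻¹ (x̄≡X s₄))) ⟩
      (X (suc j) + X j) * (y (suc (j ℕ.+ k)) * y (j ℕ.+ k))
        ≈⟨ *-cong (+-comm _ _) (*-comm _ _) ⟩
      f j
        ∎

    f̄≈e : Mirrored k M.f e
    f̄≈e i j 1+i+j≡k = let (s₁ , s₂ , s₃ , s₄) = mirror-sums {i} {j} 1+i+j≡k in begin
      M.f i
        ≡⟨ ≡.cong₂ _*_ (≡.cong₂ _+_ (x̄≡X s₃) (x̄≡X s₄)) (≡.cong₂ _*_ (≡.cong _⁻¹ (x̄≡X s₁)) (≡.cong _⁻¹ (x̄≡X s₂))) ⟩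
      (X (suc (j ℕ.+ k)) + X (j ℕ.+ k)) * (y (suc j) * y j)
        ≈⟨ *-cong (+-comm _ _) (*-comm _ _) ⟩
      e j
        ∎

    t̄≈t̃ : Mirrored k M.t t̃
    t̄≈t̃ i j 1+i+j≡k = let (s₁ , s₂ , s₃ , s₄) = mirror-sums {i} {j} 1+i+j≡k in begin
      M.t i
        ≡⟨ ≡.cong₂ _*_ (≡.cong _⁻¹ (x̄≡X s₃)) (≡.cong₂ _+_ (≡.cong _⁻¹ (x̄≡X s₁)) (≡.cong _⁻¹ (x̄≡X s₂))) ⟩
      y (suc (j ℕ.+ k)) * (y (suc j) + y j)
        ≈⟨ trans (*-comm _ _) (*-congʳ (+-comm _ _)) ⟩
      t̃ j
        ∎

    x-2k : x (ℤ.- (+ (2 ℕ.* k))) ≈ X 0 * (X 0 * y (2 ℕ.* k) + a * (S + (X 0 * y (2 ℕ.* k) * E + a * (D + T̃))))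
    x-2k = begin
      x (ℤ.- (+ (2 ℕ.* k)))
        ≡⟨ ≡.cong x (K-[K+K]≡-K (+ (2 ℕ.* k))) ⟨
      x̄ (+ (2 ℕ.* k ℕ.+ 2 ℕ.* k))
        ≡⟨ ≡.cong (x̄ ∘ +_) (2k+2k≡4k k) ⟩
      x̄ (+ (4 ℕ.* k))
        ≈⟨ M.Forward.X-4k (Recurrence-reflect x (+ (2 ℕ.* k)) rec) (λ n → x≉0 _) ⟩
      x̄ (+ (2 ℕ.* k)) * (M.ratio 0 + a * (M.E + (M.ratio 0 * M.S + a * (M.D + M.T))))
        ≡⟨ ≡.cong₂ (λ p r → p * (r + a * (M.E + (r * M.S + a * (M.D + M.T))))) x̄₂ₖ≡X₀ ratio̅₀≡ ⟩
      X 0 * (r + a * (M.E + (r * M.S + a * (M.D + M.T))))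
        ≈⟨ *-congˡ (+-congˡ (*-congˡ (+-cong (sumBelow-reverse k ē≈f) (+-cong
             (*-congˡ (sumBelow-reverse k f̄≈e))
             (*-congˡ (+-cong (doubleSum-reverse k f̄≈e ē≈f) (sumBelow-reverse k t̄≈t̃))))))) ⟩
      X 0 * (r + a * (S + (r * E + a * (D + T̃))))
        ∎
      where
      r : Carrier
      r = X 0 * y (2 ℕ.* k)
      x̄₂ₖ≡X₀ : x̄ (+ (2 ℕ.* k)) ≡ X 0
      x̄₂ₖ≡X₀ = x̄≡X (ℕ.+-identityʳ (2 ℕ.* k))
      ratio̅₀≡ : M.ratio 0 ≡ r
      ratio̅₀≡ = ≡.cong₂ (λ p q → p * q ⁻¹) x̄₂ₖ≡X₀ (x̄≡X {0} ≡.refl)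

  module Proposition (x : ℤ → Carrier) (rec : Somos.Recurrence F k a x) (x≉0 : ∀ n → ¬ x n ≈ 0#) where
    open Somos F k a x
    open Orbit x
    open Forward rec x≉0 using (X≉0; X*y≈1; X-4k)
    open Mirror x rec x≉0 using (x-2k)
    open import Algebra.Properties.Group +-group using (∙-cancelʳ)
    open import Algebra.Properties.Ring ring using ([y-z]x≈yx-zx)

    α β u v w : Carrier
    α = X 0
    β = X (2 ℕ.* k)
    u = y 0
    v = y (2 ℕ.* k)
    w = y k

    P : Carrier
    P = (1# + α * v + β * u) + a * ((1# + β * u) * S + (1# + α * v) * E) + (a * a) * (w * v + T + D)

    balance : x (+ (4 ℕ.* k)) + α * P ≈ x (ℤ.- (+ (2 ℕ.* k))) + β * P
    balance = ∙-cancelʳ K _ _ (begin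
      x (+ (4 ℕ.* k)) + α * P + K
        ≈⟨ +-cong (+-congʳ X-4k) (+-cong (+-congˡ (sym (trans (*-congʳ (X*y≈1 (2 ℕ.* k))) (*-identityˡ c₂))))
                                         (*-congˡ (sym T̃+y₀yₖ≈T+yₖy₂ₖ))) ⟩
      β * F₊ + α * P + (c₁ + β * v * c₂ + a * a * α * (T̃ + u * w))
        ≈⟨ solve 11 (λ α β u v w a S E D T T̃ → let
               P = (con 1 :+ α :* v :+ β :* u) :+ a :* ((con 1 :+ β :* u) :* S :+ (con 1 :+ α :* v) :* E)
                   :+ (a :* a) :* (w :* v :+ T :+ D)
               c₁ = β :+ a :* β :* S :+ a :* a :* w
               c₂ = α :+ a :* α :* E :+ a :* a :* w
             in β :* (β :* u :+ a :* (E :+ (β :* u :* S :+ a :* (D :+ T)))) :+ α :* P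
                  :+ (c₁ :+ β :* v :* c₂ :+ a :* a :* α :* (T̃ :+ u :* w))
             := α :* (α :* v :+ a :* (S :+ (α :* v :* E :+ a :* (D :+ T̃)))) :+ β :* P
                  :+ (α :* u :* c₁ :+ c₂ :+ a :* a :* α :* (T :+ w :* v)))
             refl α β u v w a S E D T T̃ ⟩
      α * F₋ + β * P + (α * u * c₁ + c₂ + a * a * α * (T + w * v))
        ≈⟨ +-cong (+-congʳ (sym x-2k)) (+-congʳ (+-congʳ (trans (*-congʳ (X*y≈1 0)) (*-identityˡ c₁)))) ⟩
      x (ℤ.- (+ (2 ℕ.* k))) + β * P + K
        ∎)
      where
      c₁ c₂ K F₊ F₋ : Carrier
      c₁ = β + a * β * S + a * a * w
      c₂ = α + a * α * E + a * a * w
      K = c₁ + c₂ + a * a * α * (T + w * v)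
      F₊ = β * u + a * (E + (β * u * S + a * (D + T)))
      F₋ = α * v + a * (S + (α * v * E + a * (D + T̃)))

    difference : x (+ (4 ℕ.* k)) - x (ℤ.- (+ (2 ℕ.* k))) ≈ (β - α) * P
    difference = trans (x+y≈z+w⇒x-z≈w-y balance) (sym ([y-z]x≈yx-zx P β α))

    quotient-term : ∀ l m →
      ((X l + X (l ℕ.+ 1)) * (X (k ℕ.+ suc m ℕ.∸ 1) + X (k ℕ.+ suc m)))
        / (X (k ℕ.+ l) * X (k ℕ.+ l ℕ.+ 1) * X m * X (suc m))
      ≈ f l * e m
    quotient-term l m
      rewrite ℕ.+-comm l 1 | ℕ.+-comm k (suc m) | ℕ.+-comm k l | ℕ.+-comm (l ℕ.+ k) 1 = begin
      (A₁ + A₂) * (B₁ + B₂) * (X (l ℕ.+ k) * X (suc (l ℕ.+ k)) * X m * X (suc m)) ⁻¹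
        ≈⟨ *-congˡ (trans (⁻¹-distrib-* (*-nonzero (*-nonzero (X≉0 _) (X≉0 _)) (X≉0 _)) (X≉0 _))
             (*-congʳ (trans (⁻¹-distrib-* (*-nonzero (X≉0 _) (X≉0 _)) (X≉0 _))
                             (*-congʳ (⁻¹-distrib-* (X≉0 _) (X≉0 _)))))) ⟩
      (A₁ + A₂) * (B₁ + B₂) * (y (l ℕ.+ k) * y (suc (l ℕ.+ k)) * y m * y (suc m))
        ≈⟨ solve 8 (λ A₁ A₂ B₁ B₂ y₁ y₂ y₃ y₄ →
                    (A₁ :+ A₂) :* (B₁ :+ B₂) :* (y₁ :* y₂ :* y₃ :* y₄)
                    := ((A₁ :+ A₂) :* (y₁ :* y₂)) :* ((B₁ :+ B₂) :* (y₃ :* y₄)))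
             refl A₁ A₂ B₁ B₂ (y (l ℕ.+ k)) (y (suc (l ℕ.+ k))) (y m) (y (suc m)) ⟩
      f l * e m
        ∎
      where
      A₁ A₂ B₁ B₂ : Carrier
      A₁ = X l
      A₂ = X (suc l)
      B₁ = X (m ℕ.+ k)
      B₂ = X (suc (m ℕ.+ k))

    P0+aP1+a²P2≈P : k ≥ 1 → P0 + a * P1 + (a * a) * P2 ≈ P
    P0+aP1+a²P2≈P k≥1 = +-cong (+-congˡ (*-congˡ (+-cong (*-congˡ (sumBelow-cong k λ _ → *-congˡ (⁻¹-distrib-* (X≉0 _) (X≉0 _))))
                                               (*-congˡ (sumBelow-cong k λ _ → *-congˡ (⁻¹-distrib-* (X≉0 _) (X≉0 _)))))))
                     (*-congˡ (+-cong (+-cong corner middle) double))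
      where
      corner : 1# / (X k * X (2 ℕ.* k)) ≈ w * v
      corner = trans (*-identityˡ _) (⁻¹-distrib-* (X≉0 k) (X≉0 (2 ℕ.* k)))
      middle : sumBelow k (λ j → (1# / X j) * ((1# / X (j ℕ.+ k)) + (1# / X (j ℕ.+ k ℕ.+ 1)))) ≈ T
      middle = sumBelow-cong k λ j → *-cong (*-identityˡ _)
        (+-cong (*-identityˡ _) (trans (*-identityˡ _) (reflexive (≡.cong y (ℕ.+-comm (j ℕ.+ k) 1)))))
      double : sum1to (k ℕ.∸ 1) (λ l → sum1to l (λ m →
                 ((X l + X (l ℕ.+ 1)) * (X (k ℕ.+ m ℕ.∸ 1) + X (k ℕ.+ m)))
                   / (X (k ℕ.+ l) * X (k ℕ.+ l ℕ.+ 1) * X (m ℕ.∸ 1) * X m)))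
               ≈ D
      double = begin
        sumBelow (k ℕ.∸ 1) (λ i → sumBelow (suc i) (λ j → _))
          ≈⟨ sumBelow-cong (k ℕ.∸ 1) (λ i →
               trans (sumBelow-cong (suc i) (quotient-term (suc i))) (sumBelow-*ˡ (suc i) (f (suc i)) e)) ⟩
        sumBelow (k ℕ.∸ 1) (λ i → f (suc i) * sumBelow (suc i) e)
          ≈⟨ doubleSum-suc (k ℕ.∸ 1) f e ⟨
        doubleSum (suc (k ℕ.∸ 1)) f e
          ≡⟨ ≡.cong (λ n → doubleSum n f e) (ℕ.m+[n∸m]≡n k≥1) ⟩
        D
          ∎

proposition2p8 : ∀ {c ℓ} (F : Field c ℓ) → CharZero F → (k : ℕ) → k ≥ 1 →
    (a : Field.Carrier F) (x : ℤ → Field.Carrier F) →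
    Somos.Recurrence F k a x →
    (∀ n → ¬ (Field._≈_ F (x n) (Field.0# F))) →
    ¬ (Field._≈_ F (Field._-_ F (x (+ (2 ℕ.* k))) (x (+ 0))) (Field.0# F)) →
    let open Field F in
    let open Somos F k a x in
    ((x (+ (4 ℕ.* k)) - x (ℤ.- (+ (2 ℕ.* k)))) / (x (+ (2 ℕ.* k)) - x (+ 0)))
      ≈ (P0 + (a * P1) + ((a * a) * P2))
proposition2p8 F _ k k≥1 a x rec x≉0 β-α≉0 = begin
  (x (+ (4 ℕ.* k)) - x (ℤ.- (+ (2 ℕ.* k)))) / (β - α)   ≈⟨ *-congʳ difference ⟩
  ((β - α) * P) / (β - α)                               ≈⟨ *-assoc _ _ _ ⟩
  (β - α) * (P / (β - α))                               ≈⟨ *-cancel-/ P β-α≉0 ⟩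
  P                                                     ≈⟨ P0+aP1+a²P2≈P k≥1 ⟨
  P0 + a * P1 + a * a * P2                              ∎
  where
  open Field F
  open FieldProperties F
  open Somos F k a x using (P0; P1; P2)
  open SomosProperties.Proposition F k a x rec x≉0
  open import Relation.Binary.Reasoning.Setoid setoid
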